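{- If $n_3 \ge 3$ is odd, then $\mathrm{ip}(K_2 \Box K_2 \Box K_{n_3}) = n_3 + 1$.
   Context: An isometric path between two vertices of a graph is a shortest path joining them. The isometric path number $\mathrm{ip}(G)$ of a graph $G$ is the minimum number of isometric paths needed to cover all vertices of $G$. $K_m$ denotes the complete graph on $m$ vertices. The Cartesian product $K_{n_1} \Box \cdots \Box K_{n_r}$ has vertex set $\{(x_1,\ldots,x_r) : 0 \le x_i < n_i\}$, with two vertices adjacent if and only if they differ in exactly one coordinate. -}

module Defs where

open import Data.Nat using (ℕ; _≤_)
open import Data.Fin using (Fin)
open import Data.List using (List; []; _∷_; length)
open import Data.List.Relation.Unary.All using (All)
open import Data.List.Relation.Unary.Any using (Any)
open import Data.List.Relation.Unary.Linked using (Linked)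
open import Data.List.Membership.Propositional using (_∈_)
open import Data.Product using (Σ; _×_; _,_; proj₁; proj₂)
open import Relation.Binary.PropositionalEquality using (_≡_; _≢_)

-- A walk is given by its start vertex u and the list xs of the
-- remaining vertices; consecutive vertices of (u ∷ xs) are adjacent.
-- Its length (number of edges) is  length xs.

endpoint : {V : Set} → V → List V → V
endpoint u []       = u
endpoint u (x ∷ xs) = endpoint x xs

IsWalk : {V : Set} (Adj : V → V → Set) → V → List V → Set
IsWalk Adj u xs = Linked Adj (u ∷ xs)

IsIsometricPath : {V : Set} (Adj : V → V → Set) → V → List V → Set
IsIsometricPath {V} Adj u xs =
  IsWalk Adj u xs ×
  ((ys : List V) → IsWalk Adj u ys → endpoint u ys ≡ endpoint u xs →
     length xs ≤ length ys)

PathData : Set → Set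
PathData V = Σ V (λ _ → List V)

vertices : {V : Set} → PathData V → List V
vertices (u , xs) = u ∷ xs

IsIsometricPathCover : {V : Set} (Adj : V → V → Set) → List (PathData V) → Set
IsIsometricPathCover {V} Adj ps =
  All (λ p → IsIsometricPath Adj (proj₁ p) (proj₂ p)) ps ×
  ((v : V) → Any (λ p → v ∈ vertices p) ps)

IsometricPathNumber : {V : Set} (Adj : V → V → Set) → ℕ → Set
IsometricPathNumber {V} Adj m =
  Σ (List (PathData V)) (λ ps → IsIsometricPathCover Adj ps × length ps ≡ m) ×
  ((ps : List (PathData V)) → IsIsometricPathCover Adj ps → m ≤ length ps)

data Tuple : List ℕ → Set where
  []  : Tuple []
  _∷_ : {n : ℕ} {ns : List ℕ} → Fin n → Tuple ns → Tuple (n ∷ ns)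

data DiffInExactlyOne : {ns : List ℕ} → Tuple ns → Tuple ns → Set where
  here  : {n : ℕ} {ns : List ℕ} {x y : Fin n} {xs : Tuple ns} →
          x ≢ y → DiffInExactlyOne (x ∷ xs) (y ∷ xs)
  there : {n : ℕ} {ns : List ℕ} {x : Fin n} {xs ys : Tuple ns} →
          DiffInExactlyOne xs ys → DiffInExactlyOne (x ∷ xs) (x ∷ ys)

ProdKAdj : (ns : List ℕ) → Tuple ns → Tuple ns → Set
ProdKAdj ns = DiffInExactlyOne {ns}

-- Geodesics in a Hamming graph change every coordinate at most once, so an isometric path in
-- K₂ □ K₂ □ Kₙ has at most four vertices, and pairing up consecutive layers (copies of the
-- 4-cycle K₂ □ K₂) gives a cover by n + 1 paths. A cover by at most n paths must consist of n
-- antipodal geodesics partitioning the 4n vertices; each meets exactly two layers, and each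
-- layer meets exactly two of them, in complementary traces. Colour the traces so that
-- complementary traces agree while the two traces of an antipodal geodesic of the cube differ
-- (a finite check). Then every path has exactly one trace of colour 1 and every layer holds an
-- even number of them, so n is even.
module Submission where

open import Defs
import Data.Nat.Properties as ℕ
open import Algebra.Properties.CommutativeSemigroup ℕ.+-commutativeSemigroup
  using (interchange; x∙yz≈y∙xz)
open import Algebra.Properties.Semiring.Sum ℕ.+-*-semiring
  using (sum; sum-syntax; sum-cong-≗; sum-replicate-zero; ∑-comm; ∑-distrib-+; *-distribˡ-sum)
open import Data.Bool using (Bool; true; false; not; _∧_; _∨_; if_then_else_)
open import Data.Bool.Properties using (not-involutive)
open import Data.Fin using (Fin; zero; suc; _↑ʳ_)
open import Data.Fin.Patterns using (0F; 1F)
open import Data.Fin.Properties using (_≟_; ↑ʳ-injective)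
import Data.Fin.Properties as Fin
open import Data.List using (List; []; _∷_; length; map; lookup)
open import Data.List.Properties using (length-map)
open import Data.List.Membership.Propositional using (_∈_)
open import Data.List.Membership.Propositional.Properties using (∈-map⁺; ∈-map⁻; ∈-lookup)
open import Data.List.Relation.Unary.All as All using (All; []; _∷_)
import Data.List.Relation.Unary.All.Properties as All
open import Data.List.Relation.Unary.Any as Any using (Any; here; there; any?)
import Data.List.Relation.Unary.Any.Properties as Any
open import Data.List.Relation.Unary.Linked as Linked using ([-]; _∷_; linked?)
import Data.List.Relation.Unary.Linked.Properties as Linked
open import Data.Nat using (ℕ; zero; suc; _+_; _*_; _⊓_; _≤_; _<_; z≤n; s≤s; s≤s⁻¹; _≤?_)
open import Data.Nat.Properties
  using (≤-reflexive; ≤-trans; ≤-antisym; +-mono-≤; +-monoˡ-≤; +-monoʳ-≤; +-cancelˡ-≤;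
         +-cancelʳ-≤; +-assoc; +-identityʳ; *-identityʳ; *-suc; *-cancelʳ-≤; m≤m+n; m⊓n≤m;
         n≤0⇒n≡0; <-irrefl; even≢odd; ≰⇒>; module ≤-Reasoning)
open import Data.Product using (Σ; ∃; ∃₂; _×_; _,_; proj₁; proj₂; uncurry)
open import Data.Sum using (_⊎_; inj₁; inj₂; [_,_]′)
open import Data.Unit using (⊤; tt)
open import Data.Vec.Functional using (Vector)
open import Function using (_∘_; mk⇔)
open import Relation.Binary.Definitions using (DecidableEquality)
open import Relation.Binary.PropositionalEquality
  using (_≡_; _≢_; refl; sym; trans; cong; cong₂; subst; subst₂; module ≡-Reasoning)
open import Relation.Nullary using (Dec; yes; no; does; map′; contradiction; _×-dec_; _→-dec_)
open import Relation.Nullary.Decidable using (dec-true; dec-false; does-⇔; toWitness)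
import Relation.Unary as U

Bool→ℕ : Bool → ℕ
Bool→ℕ true  = 1
Bool→ℕ false = 0

∑-mono-≤ : ∀ {n} {f g : Vector ℕ n} → (∀ i → f i ≤ g i) → sum f ≤ sum g
∑-mono-≤ {zero}  _   = z≤n
∑-mono-≤ {suc n} f≤g = +-mono-≤ (f≤g zero) (∑-mono-≤ (f≤g ∘ suc))

∑-mono-≤-tight : ∀ {n} {f g : Vector ℕ n} → (∀ i → f i ≤ g i) → sum g ≤ sum f → ∀ i → f i ≡ g i
∑-mono-≤-tight {suc n} {f} {g} f≤g g≤f zero = ≤-antisym (f≤g zero)
  (+-cancelʳ-≤ _ _ _ (≤-trans g≤f (+-monoʳ-≤ (f zero) (∑-mono-≤ (f≤g ∘ suc)))))
∑-mono-≤-tight {suc n} {f} {g} f≤g g≤f (suc i) = ∑-mono-≤-tight (f≤g ∘ suc)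
  (+-cancelˡ-≤ (g zero) _ _ (≤-trans g≤f (+-monoˡ-≤ _ (f≤g zero)))) i

∑-const : ∀ n c → ∑[ i < n ] c ≡ n * c
∑-const zero    c = refl
∑-const (suc n) c = cong (c +_) (∑-const n c)

∑-select : ∀ {n} (x : Fin n) b → ∑[ y < n ] Bool→ℕ (does (y ≟ x) ∧ b) ≡ Bool→ℕ b
∑-select {suc n} zero    b = trans (cong (Bool→ℕ b +_) (sum-replicate-zero n)) (+-identityʳ _)
∑-select {suc n} (suc x) b = ∑-select x b

erase : ∀ {n} → Fin n → Vector ℕ n → Vector ℕ n
erase p f i = if does (i ≟ p) then 0 else f i

erase-≡ : ∀ {n} p (f : Vector ℕ n) → erase p f p ≡ 0
erase-≡ p f = cong (if_then 0 else f p) (dec-true (p ≟ p) refl)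

erase-≢ : ∀ {n} {p i} (f : Vector ℕ n) → i ≢ p → erase p f i ≡ f i
erase-≢ {i = i} f i≢p = cong (if_then 0 else f i) (dec-false (i ≟ _) i≢p)

∑-erase : ∀ {n} (f : Vector ℕ n) p → sum f ≡ f p + sum (erase p f)
∑-erase {suc n} f zero    = refl
∑-erase {suc n} f (suc p) =
  trans (cong (f zero +_) (∑-erase (f ∘ suc) p)) (x∙yz≈y∙xz (f zero) (f (suc p)) (sum (erase p (f ∘ suc))))

term≤∑ : ∀ {n} (f : Vector ℕ n) i → f i ≤ sum f
term≤∑ f i = subst (f i ≤_) (sym (∑-erase f i)) (m≤m+n _ _)

∑≡0⇒≡0 : ∀ {n} (f : Vector ℕ n) → sum f ≡ 0 → ∀ i → f i ≡ 0
∑≡0⇒≡0 f ∑f≡0 i = n≤0⇒n≡0 (subst (f i ≤_) ∑f≡0 (term≤∑ f i))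

∑-positive : ∀ {n} (f : Vector ℕ n) → 0 < sum f → ∃ λ i → 0 < f i
∑-positive {suc n} f pos with f zero in eq
... | suc _ = zero , subst (0 <_) (sym eq) (s≤s z≤n)
... | zero  = let i , 0<fi = ∑-positive (f ∘ suc) pos in suc i , 0<fi

∑-two-point : ∀ {n} (f : Vector ℕ n) {p q} → p ≢ q →
              (∀ r → r ≢ p → r ≢ q → f r ≡ 0) → sum f ≡ f p + f q
∑-two-point {n} f {p} {q} p≢q elsewhere = begin
  sum f                                            ≡⟨ ∑-erase f p ⟩
  f p + sum (erase p f)                            ≡⟨ cong (f p +_) (∑-erase (erase p f) q) ⟩
  f p + (erase p f q + sum (erase q (erase p f)))  ≡⟨ cong (λ x → f p + (erase p f q + x)) rest≡0 ⟩
  f p + (erase p f q + 0)                          ≡⟨ cong (f p +_) (+-identityʳ _) ⟩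
  f p + erase p f q                                ≡⟨ cong (f p +_) (erase-≢ f (p≢q ∘ sym)) ⟩
  f p + f q                                        ∎
  where
  open ≡-Reasoning
  rest≡0 : sum (erase q (erase p f)) ≡ 0
  rest≡0 = trans (sum-cong-≗ vanishes) (sum-replicate-zero n)
    where
    vanishes : ∀ r → erase q (erase p f) r ≡ 0
    vanishes r with r ≟ q | r ≟ p
    ... | yes _  | _      = refl
    ... | no _   | yes _  = refl
    ... | no r≢q | no r≢p = elsewhere r r≢p r≢q

supported-on-two-≤ : ∀ {n} (f : Vector ℕ n) {p q k} → (∀ r → r ≢ p → r ≢ q → f r ≡ 0) →
                     f p ≤ k → f q ≤ k → ∀ r → f r ≤ k
supported-on-two-≤ f {p} {q} elsewhere fp≤k fq≤k r with r ≟ p | r ≟ q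
... | yes refl | _        = fp≤k
... | no _     | yes refl = fq≤k
... | no r≢p   | no r≢q   = subst (_≤ _) (sym (elsewhere r r≢p r≢q)) z≤n

two-support : ∀ {n} (f : Vector ℕ n) → (∀ i → f i ≤ 1) → sum f ≡ 2 →
              ∃₂ λ p q → p ≢ q × (∀ r → r ≢ p → r ≢ q → f r ≡ 0)
two-support f f≤1 ∑f≡2 = p , q , p≢q , elsewhere
  where
  first = ∑-positive f (subst (0 <_) (sym ∑f≡2) (s≤s z≤n))
  p = proj₁ first
  f₁ = erase p f
  ∑f₁≡1 : sum f₁ ≡ 1
  ∑f₁≡1 = ℕ.+-cancelˡ-≡ 1 _ _ (begin
    1 + sum f₁    ≡⟨ cong (_+ sum f₁) (≤-antisym (f≤1 p) (proj₂ first)) ⟨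
    f p + sum f₁  ≡⟨ ∑-erase f p ⟨
    sum f         ≡⟨ ∑f≡2 ⟩
    2             ∎)
    where open ≡-Reasoning
  second = ∑-positive f₁ (subst (0 <_) (sym ∑f₁≡1) (s≤s z≤n))
  q = proj₁ second
  p≢q : p ≢ q
  p≢q p≡q = <-irrefl (sym (trans (cong f₁ (sym p≡q)) (erase-≡ p f))) (proj₂ second)
  rest≡0 : sum (erase q f₁) ≡ 0
  rest≡0 = n≤0⇒n≡0 (+-cancelˡ-≤ 1 _ 0
    (≤-trans (+-monoˡ-≤ _ (proj₂ second)) (≤-reflexive (trans (sym (∑-erase f₁ q)) ∑f₁≡1))))
  elsewhere : ∀ r → r ≢ p → r ≢ q → f r ≡ 0
  elsewhere r r≢p r≢q = trans (sym (trans (erase-≢ f₁ r≢q) (erase-≢ f r≢p))) (∑≡0⇒≡0 _ rest≡0 r)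

+-tight : ∀ {a a′ b b′} → a ≤ a′ → b ≤ b′ → a′ + b′ ≡ a + b → a′ ≡ a × b′ ≡ b
+-tight {a} {a′} {b} {b′} a≤a′ b≤b′ eq =
  ≤-antisym (+-cancelʳ-≤ b′ a′ a (≤-trans (≤-reflexive eq) (+-monoʳ-≤ a b≤b′))) a≤a′ ,
  ≤-antisym (+-cancelˡ-≤ a′ b′ b (≤-trans (≤-reflexive eq) (+-monoˡ-≤ b a≤a′))) b≤b′

-- Hamming graphs

δ : ∀ {n} → Fin n → Fin n → ℕ
δ x y = if does (x ≟ y) then 0 else 1

δ-refl : ∀ {n} (x : Fin n) → δ x x ≡ 0
δ-refl x = cong (if_then 0 else 1) (dec-true (x ≟ x) refl)

δ-≢ : ∀ {n} {x y : Fin n} → x ≢ y → δ x y ≡ 1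
δ-≢ {x = x} {y} x≢y = cong (if_then 0 else 1) (dec-false (x ≟ y) x≢y)

δ-≤1 : ∀ {n} (x y : Fin n) → δ x y ≤ 1
δ-≤1 x y with x ≟ y
... | yes _ = z≤n
... | no _  = s≤s z≤n

δ-triangle : ∀ {n} (x y z : Fin n) → δ x z ≤ δ x y + δ y z
δ-triangle x y z with x ≟ z | x ≟ y | y ≟ z
... | yes _   | _       | _       = z≤n
... | no _    | no _    | _       = s≤s z≤n
... | no _    | yes _   | no _    = s≤s z≤n
... | no x≢z  | yes x≡y | yes y≡z = contradiction (trans x≡y y≡z) x≢z

δ-between : ∀ {n} (x y z : Fin n) → δ x y + δ y z ≡ δ x z → y ≡ x ⊎ y ≡ z
δ-between x y z eq with y ≟ x | y ≟ z
... | yes y≡x | _       = inj₁ y≡x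
... | no _    | yes y≡z = inj₂ y≡z
... | no y≢x  | no _    = contradiction
  (subst (_≤ 1) (trans (sym eq) (cong (_+ 1) (δ-≢ (y≢x ∘ sym)))) (δ-≤1 x z)) λ { (s≤s ()) }

hamming : ∀ {ns} → Tuple ns → Tuple ns → ℕ
hamming []      []      = 0
hamming (x ∷ u) (y ∷ v) = δ x y + hamming u v

hamming-refl : ∀ {ns} (u : Tuple ns) → hamming u u ≡ 0
hamming-refl []      = refl
hamming-refl (x ∷ u) = cong₂ _+_ (δ-refl x) (hamming-refl u)

hamming-triangle : ∀ {ns} (u v w : Tuple ns) → hamming u w ≤ hamming u v + hamming v w
hamming-triangle []      []      []      = z≤n
hamming-triangle (x ∷ u) (y ∷ v) (z ∷ w) =
  ≤-trans (+-mono-≤ (δ-triangle x y z) (hamming-triangle u v w))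
          (≤-reflexive (interchange (δ x y) (δ y z) (hamming u v) (hamming v w)))

hamming≤length : ∀ {ns} (u v : Tuple ns) → hamming u v ≤ length ns
hamming≤length []      []      = z≤n
hamming≤length (x ∷ u) (y ∷ v) = +-mono-≤ (δ-≤1 x y) (hamming≤length u v)

hamming-adjacent : ∀ {ns} {u v : Tuple ns} → ProdKAdj ns u v → hamming u v ≡ 1
hamming-adjacent {u = x ∷ u} (here x≢y) = cong₂ _+_ (δ-≢ x≢y) (hamming-refl u)
hamming-adjacent {u = x ∷ u} (there d)  = cong₂ _+_ (δ-refl x) (hamming-adjacent d)

data Between : ∀ {ns} → Tuple ns → Tuple ns → Tuple ns → Set where
  []  : Between [] [] []
  _∷_ : ∀ {n ns} {x y z : Fin n} {u w v : Tuple ns} →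
        y ≡ x ⊎ y ≡ z → Between u w v → Between (x ∷ u) (y ∷ w) (z ∷ v)

hamming-between : ∀ {ns} (u w v : Tuple ns) → hamming u w + hamming w v ≡ hamming u v → Between u w v
hamming-between []      []      []      _  = []
hamming-between (x ∷ u) (y ∷ w) (z ∷ v) eq =
  δ-between x y z (proj₁ tight) ∷ hamming-between u w v (proj₂ tight)
  where
  tight = +-tight (δ-triangle x y z) (hamming-triangle u w v)
                  (trans (sym (interchange (δ x y) (hamming u w) (δ y z) (hamming w v))) eq)

∷-injective : ∀ {n ns} {x y : Fin n} {u v : Tuple ns} → Tuple._∷_ x u ≡ y ∷ v → x ≡ y × u ≡ v
∷-injective refl = refl , refl

infix 4 _≟ᵗ_ _∈?_

_≟ᵗ_ : ∀ {ns} → DecidableEquality (Tuple ns)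
[]      ≟ᵗ []      = yes refl
(x ∷ u) ≟ᵗ (y ∷ v) = map′ (uncurry (cong₂ _∷_)) ∷-injective (x ≟ y ×-dec u ≟ᵗ v)

_∈?_ : ∀ {ns} (v : Tuple ns) (L : List (Tuple ns)) → Dec (v ∈ L)
v ∈? L = any? (v ≟ᵗ_) L

adjacent? : ∀ {ns} (u v : Tuple ns) → Dec (ProdKAdj ns u v)
adjacent? []      []      = no λ ()
adjacent? (x ∷ u) (y ∷ v) with x ≟ y
... | yes refl = map′ there (λ { (there d) → d ; (here x≢x) → contradiction refl x≢x }) (adjacent? u v)
... | no x≢y   = map′ (λ { refl → here x≢y })
                      (λ { (here _) → refl ; (there _) → contradiction refl x≢y }) (u ≟ᵗ v)

∀ᵗ? : ∀ {ns} {P : Tuple ns → Set} → U.Decidable P → Dec (∀ t → P t)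
∀ᵗ? {[]}     P? = map′ (λ p → λ { [] → p }) (λ p → p []) (P? [])
∀ᵗ? {n ∷ ns} P? = map′ (λ p → λ { (x ∷ t) → p x t }) (λ p x t → p (x ∷ t))
                        (Fin.all? λ x → ∀ᵗ? λ t → P? (x ∷ t))

-- The last coordinate is summed outermost, so on K₂ □ K₂ □ Kₙ this is a sum over layers of cells.
∑ᵗ : ∀ {ns} → (Tuple ns → ℕ) → ℕ
∑ᵗ {[]}     f = f []
∑ᵗ {n ∷ ns} f = ∑ᵗ λ t → ∑[ x < n ] f (x ∷ t)

∑ᵗ-cong : ∀ {ns} {f g : Tuple ns → ℕ} → (∀ t → f t ≡ g t) → ∑ᵗ f ≡ ∑ᵗ g
∑ᵗ-cong {[]}     f≗g = f≗g []
∑ᵗ-cong {n ∷ ns} f≗g = ∑ᵗ-cong λ t → sum-cong-≗ λ x → f≗g (x ∷ t)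

∑ᵗ-mono-≤ : ∀ {ns} {f g : Tuple ns → ℕ} → (∀ t → f t ≤ g t) → ∑ᵗ f ≤ ∑ᵗ g
∑ᵗ-mono-≤ {[]}     f≤g = f≤g []
∑ᵗ-mono-≤ {n ∷ ns} f≤g = ∑ᵗ-mono-≤ λ t → ∑-mono-≤ λ x → f≤g (x ∷ t)

∑ᵗ-mono-≤-tight : ∀ {ns} {f g : Tuple ns → ℕ} → (∀ t → f t ≤ g t) → ∑ᵗ g ≤ ∑ᵗ f →
                  ∀ t → f t ≡ g t
∑ᵗ-mono-≤-tight {[]}     f≤g g≤f [] = ≤-antisym (f≤g []) g≤f
∑ᵗ-mono-≤-tight {n ∷ ns} f≤g g≤f (x ∷ t) = ∑-mono-≤-tight (λ y → f≤g (y ∷ t))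
  (≤-reflexive (sym (∑ᵗ-mono-≤-tight (λ t → ∑-mono-≤ λ y → f≤g (y ∷ t)) g≤f t))) x

∑ᵗ-distrib-+ : ∀ {ns} (f g : Tuple ns → ℕ) → ∑ᵗ (λ t → f t + g t) ≡ ∑ᵗ f + ∑ᵗ g
∑ᵗ-distrib-+ {[]}     f g = refl
∑ᵗ-distrib-+ {n ∷ ns} f g = trans (∑ᵗ-cong λ t → ∑-distrib-+ (λ x → f (x ∷ t)) (λ x → g (x ∷ t)))
                                  (∑ᵗ-distrib-+ (λ t → ∑[ x < n ] f (x ∷ t)) (λ t → ∑[ x < n ] g (x ∷ t)))

∑ᵗ-comm : ∀ {ns m} (f : Fin m → Tuple ns → ℕ) → ∑ᵗ (λ t → ∑[ i < m ] f i t) ≡ ∑[ i < m ] ∑ᵗ (f i)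
∑ᵗ-comm {[]}     f = refl
∑ᵗ-comm {n ∷ ns} f = trans (∑ᵗ-cong λ t → ∑-comm λ x i → f i (x ∷ t))
                            (∑ᵗ-comm λ i t → ∑[ x < n ] f i (x ∷ t))

∑ᵗ-zero : ∀ {ns} → ∑ᵗ {ns} (λ _ → 0) ≡ 0
∑ᵗ-zero {[]}     = refl
∑ᵗ-zero {n ∷ ns} = trans (∑ᵗ-cong {ns} λ _ → sum-replicate-zero n) (∑ᵗ-zero {ns})

∑ᵗ-point : ∀ {ns} (x : Tuple ns) → ∑ᵗ (λ t → Bool→ℕ (does (t ≟ᵗ x))) ≡ 1
∑ᵗ-point []      = refl
∑ᵗ-point (x ∷ u) = trans (∑ᵗ-cong λ t → ∑-select x (does (t ≟ᵗ u))) (∑ᵗ-point u)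

Bool→ℕ-∨ : ∀ a b → Bool→ℕ (a ∨ b) ≤ Bool→ℕ a + Bool→ℕ b
Bool→ℕ-∨ true  _ = s≤s z≤n
Bool→ℕ-∨ false b = ≤-reflexive refl

∑ᵗ-∈≤length : ∀ {ns} (L : List (Tuple ns)) → ∑ᵗ (λ v → Bool→ℕ (does (v ∈? L))) ≤ length L
∑ᵗ-∈≤length {ns} []      = ≤-reflexive (∑ᵗ-zero {ns})
∑ᵗ-∈≤length {ns} (x ∷ L) = begin
  ∑ᵗ (λ v → [ v ∈ x ∷ L ])                                     ≤⟨ ∑ᵗ-mono-≤ (λ v → Bool→ℕ-∨ (does (v ≟ᵗ x)) _) ⟩
  ∑ᵗ (λ v → [ v ≡ x ] + [ v ∈ L ])                             ≡⟨ ∑ᵗ-distrib-+ (λ v → [ v ≡ x ]) (λ v → [ v ∈ L ]) ⟩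
  ∑ᵗ (λ v → [ v ≡ x ]) + ∑ᵗ (λ v → [ v ∈ L ])                  ≤⟨ +-mono-≤ (≤-reflexive (∑ᵗ-point x)) (∑ᵗ-∈≤length L) ⟩
  suc (length L)                                               ∎
  where
  open ≤-Reasoning
  [_≡_] : Tuple ns → Tuple ns → ℕ
  [_∈_] : Tuple ns → List (Tuple ns) → ℕ
  [ v ≡ x ] = Bool→ℕ (does (v ≟ᵗ x))
  [ v ∈ L ] = Bool→ℕ (does (v ∈? L))

endpoint-map : ∀ {A B : Set} (f : A → B) u xs → endpoint (f u) (map f xs) ≡ f (endpoint u xs)
endpoint-map f u []       = refl
endpoint-map f u (x ∷ xs) = endpoint-map f x xs

endpoint-∈ : ∀ {A : Set} (u : A) xs → endpoint u xs ∈ u ∷ xs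
endpoint-∈ u []       = here refl
endpoint-∈ u (x ∷ xs) = there (endpoint-∈ x xs)

walk-length≥hamming : ∀ {ns} {u : Tuple ns} {ys} → IsWalk (ProdKAdj ns) u ys →
                      hamming u (endpoint u ys) ≤ length ys
walk-length≥hamming {u = u} {[]}     _            = ≤-reflexive (hamming-refl u)
walk-length≥hamming {u = u} {y ∷ ys} (u~y ∷ walk) = begin
  hamming u (endpoint y ys)                ≤⟨ hamming-triangle u y _ ⟩
  hamming u y + hamming y (endpoint y ys)  ≡⟨ cong (_+ _) (hamming-adjacent u~y) ⟩
  suc (hamming y (endpoint y ys))          ≤⟨ s≤s (walk-length≥hamming walk) ⟩
  suc (length ys)                          ∎
  where open ≤-Reasoning

∷-walk : ∀ {n ns} (x : Fin n) {w : Tuple ns} {zs} → IsWalk (ProdKAdj ns) w zs →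
         IsWalk (ProdKAdj (n ∷ ns)) (x ∷ w) (map (x ∷_) zs)
∷-walk x = Linked.map⁺ ∘ Linked.map there

hamming-walk : ∀ {ns} (u v : Tuple ns) →
               ∃ λ ys → IsWalk (ProdKAdj ns) u ys × endpoint u ys ≡ v × length ys ≡ hamming u v
hamming-walk []      []      = [] , [-] , refl , refl
hamming-walk (x ∷ u) (y ∷ v) with hamming-walk u v | x ≟ y
... | ys , walk , end , len | yes refl =
  map (x ∷_) ys , ∷-walk x walk , trans (endpoint-map (x ∷_) u ys) (cong (x ∷_) end) ,
  trans (length-map (x ∷_) ys) len
... | ys , walk , end , len | no x≢y =
  (y ∷ u) ∷ map (y ∷_) ys , here x≢y ∷ ∷-walk y walk , trans (endpoint-map (y ∷_) u ys) (cong (y ∷_) end) ,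
  cong suc (trans (length-map (y ∷_) ys) len)

Geodesic : ∀ {ns} → Tuple ns → List (Tuple ns) → Set
Geodesic {ns} u xs = IsWalk (ProdKAdj ns) u xs × length xs ≡ hamming u (endpoint u xs)

isometric⇒geodesic : ∀ {ns} {u : Tuple ns} {xs} → IsIsometricPath (ProdKAdj ns) u xs → Geodesic u xs
isometric⇒geodesic {u = u} {xs} (walk , shortest) =
  let ys , walk′ , end , len = hamming-walk u (endpoint u xs) in
  walk , ≤-antisym (subst (length xs ≤_) len (shortest ys walk′ end)) (walk-length≥hamming walk)

geodesic⇒isometric : ∀ {ns} {u : Tuple ns} {xs} → Geodesic u xs → IsIsometricPath (ProdKAdj ns) u xs
geodesic⇒isometric {u = u} (walk , len) = walk , λ ys walk′ end →
  subst (_≤ length ys) (trans (cong (hamming u) end) (sym len)) (walk-length≥hamming walk′)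

geodesic-tail : ∀ {ns} {u x : Tuple ns} {xs} → Geodesic u (x ∷ xs) → Geodesic x xs
geodesic-tail {u = u} {x} {xs} (u~x ∷ walk , len) =
  walk , ≤-antisym (s≤s⁻¹ shortcut) (walk-length≥hamming walk)
  where
  open ≤-Reasoning
  shortcut : suc (length xs) ≤ suc (hamming x (endpoint x xs))
  shortcut = begin
    suc (length xs)                                   ≡⟨ len ⟩
    hamming u (endpoint x xs)                         ≤⟨ hamming-triangle u x _ ⟩
    hamming u x + hamming x (endpoint x xs)           ≡⟨ cong (_+ _) (hamming-adjacent u~x) ⟩
    suc (hamming x (endpoint x xs))                   ∎

geodesic-between : ∀ {ns} {u w : Tuple ns} {xs} → Geodesic u xs → w ∈ u ∷ xs →
                   hamming u w + hamming w (endpoint u xs) ≡ hamming u (endpoint u xs)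
geodesic-between {u = u} {xs = xs} _ (here refl) = cong (_+ hamming u (endpoint u xs)) (hamming-refl u)
geodesic-between {u = u} {w} {x ∷ xs} g@(u~x ∷ _ , len) (there w∈) =
  ≤-antisym detour (hamming-triangle u w v)
  where
  open ≤-Reasoning
  v = endpoint x xs
  detour : hamming u w + hamming w v ≤ hamming u v
  detour = begin
    hamming u w + hamming w v                  ≤⟨ +-monoˡ-≤ _ (hamming-triangle u x w) ⟩
    (hamming u x + hamming x w) + hamming w v  ≡⟨ +-assoc (hamming u x) _ _ ⟩
    hamming u x + (hamming x w + hamming w v)  ≡⟨ cong₂ _+_ (hamming-adjacent u~x)
                                                           (geodesic-between (geodesic-tail g) w∈) ⟩
    suc (hamming x v)                          ≡⟨ cong suc (proj₂ (geodesic-tail g)) ⟨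
    suc (length xs)                            ≡⟨ len ⟩
    hamming u v                                ∎

-- The layers of K₂ □ K₂ □ Kₙ

V : ℕ → Set
V n = Tuple (2 ∷ 2 ∷ n ∷ [])

Adj : ∀ {n} → V n → V n → Set
Adj {n} = ProdKAdj (2 ∷ 2 ∷ n ∷ [])

layerOf : ∀ {n} → V n → Fin n
layerOf (_ ∷ _ ∷ z ∷ []) = z

geodesic-layers : ∀ {n} {u w : V n} {xs} → Geodesic u xs → w ∈ u ∷ xs →
                  layerOf w ≡ layerOf u ⊎ layerOf w ≡ layerOf (endpoint u xs)
geodesic-layers {u = u} {w} {xs} g w∈ =
  last (hamming-between u w (endpoint u xs) (geodesic-between g w∈))
  where
  last : ∀ {n} {u w v : V n} → Between u w v → layerOf w ≡ layerOf u ⊎ layerOf w ≡ layerOf v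
  last (_ ∷ _ ∷ between ∷ []) = between

antipodal-layers : ∀ {n} (u v : V n) → hamming u v ≡ 3 → layerOf u ≢ layerOf v
antipodal-layers (a ∷ b ∷ c ∷ []) (a′ ∷ b′ ∷ .c ∷ []) h≡3 refl = <-irrefl refl (subst (_≤ 2) h≡3
  (+-mono-≤ (δ-≤1 a a′) (+-mono-≤ (δ-≤1 b b′) (≤-reflexive (cong (_+ 0) (δ-refl c))))))

Trace : Set
Trace = Fin 2 → Fin 2 → Bool

layer : ∀ {n} → List (V n) → Fin n → Trace
layer L z a b = does ((a ∷ b ∷ z ∷ []) ∈? L)

relabel : ∀ {n n′} → (Fin n → Fin n′) → V n → V n′
relabel ρ (a ∷ b ∷ z ∷ []) = a ∷ b ∷ ρ z ∷ []

InjectiveOn : ∀ {n n′} → (Fin n → Set) → (Fin n → Fin n′) → Set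
InjectiveOn Z ρ = ∀ {z z′} → Z z → Z z′ → ρ z ≡ ρ z′ → z ≡ z′

module Relabel {n n′} {Z : Fin n → Set} {ρ : Fin n → Fin n′} (injective : InjectiveOn Z ρ) where

  InZ : V n → Set
  InZ v = Z (layerOf v)

  relabel-injective : ∀ {v w} → InZ v → InZ w → relabel ρ v ≡ relabel ρ w → v ≡ w
  relabel-injective {a ∷ b ∷ z ∷ []} {a′ ∷ b′ ∷ z′ ∷ []} zZ z′Z eq =
    let a≡a′ , eq′ = ∷-injective eq ; b≡b′ , eq″ = ∷-injective eq′ ; ρz≡ρz′ , _ = ∷-injective eq″ in
    cong₂ _∷_ a≡a′ (cong₂ _∷_ b≡b′ (cong (_∷ []) (injective zZ z′Z ρz≡ρz′)))

  relabel-adjacent : ∀ {v w} → InZ v → InZ w → Adj v w → Adj (relabel ρ v) (relabel ρ w)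
  relabel-adjacent {_ ∷ _ ∷ _ ∷ []} {_ ∷ _ ∷ _ ∷ []} _  _   (here a≢a′)                = here a≢a′
  relabel-adjacent {_ ∷ _ ∷ _ ∷ []} {_ ∷ _ ∷ _ ∷ []} _  _   (there (here b≢b′))        = there (here b≢b′)
  relabel-adjacent {_ ∷ _ ∷ _ ∷ []} {_ ∷ _ ∷ _ ∷ []} zZ z′Z (there (there (here z≢z′))) =
    there (there (here (z≢z′ ∘ injective zZ z′Z)))

  relabel-hamming : ∀ {v w} → InZ v → InZ w → hamming (relabel ρ v) (relabel ρ w) ≡ hamming v w
  relabel-hamming {a ∷ b ∷ z ∷ []} {a′ ∷ b′ ∷ z′ ∷ []} zZ z′Z =
    cong (λ d → δ a a′ + (δ b b′ + ((if d then 0 else 1) + 0)))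
         (does-⇔ (mk⇔ (injective zZ z′Z) (cong ρ)) (ρ z ≟ ρ z′) (z ≟ z′))

  relabel-geodesic : ∀ {u xs} → All InZ (u ∷ xs) → Geodesic u xs → Geodesic (relabel ρ u) (map (relabel ρ) xs)
  relabel-geodesic {u} {xs} inZ (walk , len) = relabel-walk inZ walk , (begin
    length (map (relabel ρ) xs)
      ≡⟨ length-map (relabel ρ) xs ⟩
    length xs
      ≡⟨ len ⟩
    hamming u (endpoint u xs)
      ≡⟨ relabel-hamming {u} {endpoint u xs} (All.head inZ) (All.lookup inZ (endpoint-∈ u xs)) ⟨
    hamming (relabel ρ u) (relabel ρ (endpoint u xs))
      ≡⟨ cong (hamming (relabel ρ u)) (endpoint-map (relabel ρ) u xs) ⟨
    hamming (relabel ρ u) (endpoint (relabel ρ u) (map (relabel ρ) xs)) ∎)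
    where
    open ≡-Reasoning
    relabel-walk : ∀ {v ys} → All InZ (v ∷ ys) → IsWalk Adj v ys → IsWalk Adj (relabel ρ v) (map (relabel ρ) ys)
    relabel-walk _              [-]          = [-]
    relabel-walk (vZ ∷ yZ ∷ ysZ) (v~y ∷ walk) = relabel-adjacent vZ yZ v~y ∷ relabel-walk (yZ ∷ ysZ) walk

  relabel-isometric : ∀ {u xs} → All InZ (u ∷ xs) → IsIsometricPath Adj u xs →
                      IsIsometricPath Adj (relabel ρ u) (map (relabel ρ) xs)
  relabel-isometric inZ = geodesic⇒isometric ∘ relabel-geodesic inZ ∘ isometric⇒geodesic

  relabel-∈ : ∀ {v L} → All InZ L → InZ v → relabel ρ v ∈ map (relabel ρ) L → v ∈ L
  relabel-∈ {v} {L} inZ vZ ρv∈ =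
    let w , w∈L , ρv≡ρw = ∈-map⁻ (relabel ρ) ρv∈ in
    subst (_∈ L) (sym (relabel-injective vZ (All.lookup inZ w∈L) ρv≡ρw)) w∈L

  layer-relabel : ∀ {L z} → All InZ L → Z z → ∀ a b → layer (map (relabel ρ) L) (ρ z) a b ≡ layer L z a b
  layer-relabel {L} {z} inZ zZ a b =
    does-⇔ (mk⇔ (relabel-∈ inZ zZ) (∈-map⁺ (relabel ρ)))
           (a ∷ b ∷ ρ z ∷ [] ∈? map (relabel ρ) L) (a ∷ b ∷ z ∷ [] ∈? L)

cells : Trace → ℕ
cells S = ∑[ b < 2 ] ∑[ a < 2 ] Bool→ℕ (S a b)

Empty : Trace → Set
Empty S = ∀ a b → S a b ≡ false

cells-empty : ∀ {S} → Empty S → cells S ≡ 0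
cells-empty empty = sum-cong-≗ λ b → sum-cong-≗ λ a → cong Bool→ℕ (empty a b)

Bool→ℕ≡0 : ∀ {x} → Bool→ℕ x ≡ 0 → x ≡ false
Bool→ℕ≡0 {false} _ = refl

cells≡0⇒empty : ∀ {S} → cells S ≡ 0 → Empty S
cells≡0⇒empty {S} eq a b =
  Bool→ℕ≡0 (∑≡0⇒≡0 (λ a → Bool→ℕ (S a b)) (∑≡0⇒≡0 (λ b → ∑[ a < 2 ] Bool→ℕ (S a b)) eq b) a)

∈⇒cells-positive : ∀ {n} {L : List (V n)} {a b z} → (a ∷ b ∷ z ∷ []) ∈ L → 1 ≤ cells (layer L z)
∈⇒cells-positive {L = L} {a} {b} {z} v∈L =
  subst (_≤ cells (layer L z)) (cong Bool→ℕ (dec-true (_ ∈? L) v∈L))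
        (≤-trans (term≤∑ (λ a → Bool→ℕ (layer L z a b)) a)
                 (term≤∑ (λ b → ∑[ a < 2 ] Bool→ℕ (layer L z a b)) b))

-- Cell ab is S a b. Complementing when 00 is occupied makes the colour complement-invariant;
-- among traces avoiding 00, colour 1 goes exactly to {11}, {01, 11} and {01, 10, 11}.
colour : Trace → ℕ
colour S = Bool→ℕ (if S 0F 0F then avoiding00 (not (S 0F 1F)) (not (S 1F 0F)) (not (S 1F 1F))
                               else avoiding00 (S 0F 1F) (S 1F 0F) (S 1F 1F))
  where
  avoiding00 : Bool → Bool → Bool → Bool
  avoiding00 s₀₁ s₁₀ s₁₁ = s₁₁ ∧ (s₀₁ ∨ not s₁₀)

colour-cong : ∀ {S T} → (∀ a b → S a b ≡ T a b) → colour S ≡ colour T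
colour-cong S≗T rewrite S≗T 0F 0F | S≗T 0F 1F | S≗T 1F 0F | S≗T 1F 1F = refl

colour-not : ∀ S → colour (λ a b → not (S a b)) ≡ colour S
colour-not S with S 0F 0F
... | true  = refl
... | false rewrite not-involutive (S 0F 1F) | not-involutive (S 1F 0F) | not-involutive (S 1F 1F) = refl

colour-complement : ∀ {S T} → (∀ a b → T a b ≡ not (S a b)) → colour T ≡ colour S
colour-complement {S} T≗¬S = trans (colour-cong T≗¬S) (colour-not S)

colour-empty : ∀ {S} → Empty S → colour S ≡ 0
colour-empty = colour-cong

Cube : Set
Cube = V 2

antipodal-cube-colours : (w₀ w₁ w₂ w₃ : Cube) → IsWalk Adj w₀ (w₁ ∷ w₂ ∷ w₃ ∷ []) → hamming w₀ w₃ ≡ 3 →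
  let P = w₀ ∷ w₁ ∷ w₂ ∷ w₃ ∷ [] in colour (layer P (layerOf w₀)) + colour (layer P (layerOf w₃)) ≡ 1
antipodal-cube-colours = toWitness {a? = ∀ᵗ? λ w₀ → ∀ᵗ? λ w₁ → ∀ᵗ? λ w₂ → ∀ᵗ? λ w₃ →
  linked? adjacent? _ →-dec hamming w₀ w₃ ℕ.≟ 3 →-dec _ ℕ.≟ 1} tt

record SpansTwoLayers {n} (P : List (V n)) : Set where
  field
    first last  : Fin n
    first≢last  : first ≢ last
    meets-first : 1 ≤ cells (layer P first)
    meets-last  : 1 ≤ cells (layer P last)
    outside     : ∀ z → z ≢ first → z ≢ last → Empty (layer P z)
    colours     : colour (layer P first) + colour (layer P last) ≡ 1

-- Identifies the end layers c ↦ 0 and c′ ↦ 1 of a geodesic with the two layers of the cube.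
bit : ∀ {n} → Fin n → Fin n → Fin 2
bit c z = if does (z ≟ c) then 0F else 1F

bit-injective : ∀ {n} (c c′ : Fin n) → InjectiveOn (λ z → z ≡ c ⊎ z ≡ c′) (bit c)
bit-injective c c′ {z} {z′} zZ z′Z eq with z ≟ c | z′ ≟ c
... | yes z≡c | yes z′≡c = trans z≡c (sym z′≡c)
... | no z≢c  | no z′≢c  = trans (other z≢c zZ) (sym (other z′≢c z′Z))
  where
  other : ∀ {x} → x ≢ c → x ≡ c ⊎ x ≡ c′ → x ≡ c′
  other x≢c = [ (λ x≡c → contradiction x≡c x≢c) , (λ x≡c′ → x≡c′) ]′
... | yes _ | no _  with () ← eq
... | no _  | yes _ with () ← eq

geodesic₃-spans-two-layers : ∀ {n} {u : V n} {xs} → Geodesic u xs → length xs ≡ 3 → SpansTwoLayers (u ∷ xs)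
geodesic₃-spans-two-layers {n} {u@(a ∷ b ∷ c ∷ [])} {xs@(x₁ ∷ x₂ ∷ x₃@(a′ ∷ b′ ∷ c′ ∷ []) ∷ [])}
                           g@(_ , len) refl = record
  { first       = c
  ; last        = c′
  ; first≢last  = antipodal-layers u x₃ (sym len)
  ; meets-first = ∈⇒cells-positive {L = u ∷ xs} {a} {b} {c} (here refl)
  ; meets-last  = ∈⇒cells-positive {L = u ∷ xs} {a′} {b′} {c′} (endpoint-∈ u xs)
  ; outside     = λ z z≢c z≢c′ a b →
                    dec-false (a ∷ b ∷ z ∷ [] ∈? u ∷ xs) λ v∈ → [ z≢c , z≢c′ ]′ (geodesic-layers g v∈)
  ; colours     = trans (cong₂ _+_ (colour-cong (λ a b → sym (layer-relabel inZ (inj₁ refl) a b)))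
                                   (colour-cong (λ a b → sym (layer-relabel inZ (inj₂ refl) a b))))
                        (antipodal-cube-colours _ _ _ _ (proj₁ cube) (sym (proj₂ cube)))
  }
  where
  open Relabel (bit-injective c c′)
  inZ : All InZ (u ∷ xs)
  inZ = All.tabulate (geodesic-layers g)
  cube : Geodesic (relabel (bit c) u) (map (relabel (bit c)) xs)
  cube = relabel-geodesic inZ g

-- Covers by at most n paths

module ShortCover {n} (ps : List (PathData (V n))) (cover : IsIsometricPathCover Adj ps)
                  (m≤n : length ps ≤ n) where

  m : ℕ
  m = length ps

  path : Fin m → List (V n)
  path i = vertices (lookup ps i)

  geodesic : ∀ i → Geodesic (proj₁ (lookup ps i)) (proj₂ (lookup ps i))
  geodesic i = isometric⇒geodesic (All.lookup (proj₁ cover) (∈-lookup i))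

  incidence : Fin m → V n → ℕ
  incidence i v = Bool→ℕ (does (v ∈? path i))

  covered : ∀ v → 1 ≤ ∑[ i < m ] incidence i v
  covered v = subst (_≤ sum (λ j → incidence j v)) (cong Bool→ℕ (dec-true (v ∈? path i) (Any.lookup-index v∈)))
                    (term≤∑ (λ j → incidence j v) i)
    where
    v∈ = proj₂ cover v
    i  = Any.index v∈

  length≤3 : ∀ i → length (proj₂ (lookup ps i)) ≤ 3
  length≤3 i = ≤-trans (≤-reflexive (proj₂ (geodesic i))) (hamming≤length u (endpoint u (proj₂ (lookup ps i))))
    where u = proj₁ (lookup ps i)

  path-size : ∀ i → ∑ᵗ (incidence i) ≤ 4
  path-size i = ≤-trans (∑ᵗ-∈≤length (path i)) (s≤s (length≤3 i))

  vertex-count : ∑ᵗ {2 ∷ 2 ∷ n ∷ []} (λ _ → 1) ≡ n * 4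
  vertex-count = ∑-const n 4

  n*4≤incidences : n * 4 ≤ ∑[ i < m ] ∑ᵗ (incidence i)
  n*4≤incidences = subst₂ _≤_ vertex-count (∑ᵗ-comm incidence) (∑ᵗ-mono-≤ {2 ∷ 2 ∷ n ∷ []} covered)

  incidences≤m*4 : ∑[ i < m ] ∑ᵗ (incidence i) ≤ m * 4
  incidences≤m*4 = subst (sum (λ i → ∑ᵗ (incidence i)) ≤_) (∑-const m 4) (∑-mono-≤ path-size)

  m≡n : m ≡ n
  m≡n = ≤-antisym m≤n (*-cancelʳ-≤ n m 4 (≤-trans n*4≤incidences incidences≤m*4))

  covered-once : ∀ v → ∑[ i < m ] incidence i v ≡ 1
  covered-once = sym ∘ ∑ᵗ-mono-≤-tight {2 ∷ 2 ∷ n ∷ []} covered (begin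
    ∑ᵗ (λ v → ∑[ i < m ] incidence i v)  ≡⟨ ∑ᵗ-comm incidence ⟩
    ∑[ i < m ] ∑ᵗ (incidence i)          ≤⟨ incidences≤m*4 ⟩
    m * 4                                ≡⟨ cong (_* 4) m≡n ⟩
    n * 4                                ≡⟨ vertex-count ⟨
    ∑ᵗ {2 ∷ 2 ∷ n ∷ []} (λ _ → 1)        ∎)
    where open ≤-Reasoning

  path-size≡4 : ∀ i → ∑ᵗ (incidence i) ≡ 4
  path-size≡4 = ∑-mono-≤-tight path-size (begin
    ∑[ i < m ] 4                 ≡⟨ ∑-const m 4 ⟩
    m * 4                        ≡⟨ cong (_* 4) m≡n ⟩
    n * 4                        ≤⟨ n*4≤incidences ⟩
    ∑[ i < m ] ∑ᵗ (incidence i)  ∎)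
    where open ≤-Reasoning

  spans : ∀ i → SpansTwoLayers (path i)
  spans i = geodesic₃-spans-two-layers (geodesic i) (≤-antisym (length≤3 i)
    (s≤s⁻¹ (≤-trans (≤-reflexive (sym (path-size≡4 i))) (∑ᵗ-∈≤length (path i)))))

  cellsAt occupies colourAt : Fin m → Fin n → ℕ
  cellsAt  i z = cells (layer (path i) z)
  occupies i z = 1 ⊓ cellsAt i z
  colourAt i z = colour (layer (path i) z)

  module _ (i : Fin m) where
    open SpansTwoLayers (spans i)

    private
      cells-elsewhere : ∀ z → z ≢ first → z ≢ last → cellsAt i z ≡ 0
      cells-elsewhere z z≢f z≢l = cells-empty (outside z z≢f z≢l)

      cells-split : cellsAt i first + cellsAt i last ≡ 4
      cells-split = trans (sym (∑-two-point (cellsAt i) first≢last cells-elsewhere)) (path-size≡4 i)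

    cellsAt≤3 : ∀ z → cellsAt i z ≤ 3
    cellsAt≤3 = supported-on-two-≤ (cellsAt i) cells-elsewhere
      (+-cancelʳ-≤ 1 _ 3 (≤-trans (+-monoʳ-≤ _ meets-last) (≤-reflexive cells-split)))
      (+-cancelˡ-≤ 1 _ 3 (≤-trans (+-monoˡ-≤ _ meets-first) (≤-reflexive cells-split)))

    occupies-sum : ∑[ z < n ] occupies i z ≡ 2
    occupies-sum =
      trans (∑-two-point (occupies i) first≢last (λ z z≢f z≢l → cong (1 ⊓_) (cells-elsewhere z z≢f z≢l)))
            (cong₂ _+_ (1⊓-positive meets-first) (1⊓-positive meets-last))
      where
      1⊓-positive : ∀ {k} → 1 ≤ k → 1 ⊓ k ≡ 1
      1⊓-positive (s≤s _) = refl

    colour-sum : ∑[ z < n ] colourAt i z ≡ 1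
    colour-sum =
      trans (∑-two-point (colourAt i) first≢last (λ z z≢f z≢l → colour-empty (outside z z≢f z≢l))) colours

  layer-cells : ∀ z → ∑[ i < m ] cellsAt i z ≡ 4
  layer-cells z = begin
    ∑[ i < m ] ∑[ b < 2 ] ∑[ a < 2 ] I i a b  ≡⟨ ∑-comm (λ i b → ∑[ a < 2 ] I i a b) ⟩
    ∑[ b < 2 ] ∑[ i < m ] ∑[ a < 2 ] I i a b  ≡⟨ sum-cong-≗ (λ b → ∑-comm λ i a → I i a b) ⟩
    ∑[ b < 2 ] ∑[ a < 2 ] ∑[ i < m ] I i a b  ≡⟨ sum-cong-≗ (λ b → sum-cong-≗ λ a → covered-once (a ∷ b ∷ z ∷ [])) ⟩
    4                                         ∎
    where
    open ≡-Reasoning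
    I : Fin m → Fin 2 → Fin 2 → ℕ
    I i a b = incidence i (a ∷ b ∷ z ∷ [])

  occupants : ∀ z → ∑[ i < m ] occupies i z ≡ 2
  occupants = sym ∘ ∑-mono-≤-tight at-least-two (begin
    ∑[ z < n ] ∑[ i < m ] occupies i z  ≡⟨ ∑-comm (λ z i → occupies i z) ⟩
    ∑[ i < m ] ∑[ z < n ] occupies i z  ≡⟨ sum-cong-≗ occupies-sum ⟩
    ∑[ i < m ] 2                        ≡⟨ ∑-const m 2 ⟩
    m * 2                               ≡⟨ cong (_* 2) m≡n ⟩
    n * 2                               ≡⟨ ∑-const n 2 ⟨
    ∑[ z < n ] 2                        ∎)
    where
    open ≤-Reasoning
    4≤3*k⇒2≤k : ∀ {k} → 4 ≤ 3 * k → 2 ≤ k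
    4≤3*k⇒2≤k {suc (suc k)} _                    = s≤s (s≤s z≤n)
    4≤3*k⇒2≤k {suc zero}    (s≤s (s≤s (s≤s ())))
    ≤3*[1⊓] : ∀ {k} → k ≤ 3 → k ≤ 3 * (1 ⊓ k)
    ≤3*[1⊓] {zero}  _   = z≤n
    ≤3*[1⊓] {suc k} k≤3 = k≤3
    at-least-two : ∀ z → 2 ≤ ∑[ i < m ] occupies i z
    at-least-two z = 4≤3*k⇒2≤k (begin
      4                                ≡⟨ layer-cells z ⟨
      ∑[ i < m ] cellsAt i z           ≤⟨ ∑-mono-≤ (λ i → ≤3*[1⊓] (cellsAt≤3 i z)) ⟩
      ∑[ i < m ] (3 * occupies i z)    ≡⟨ *-distribˡ-sum 3 (λ i → occupies i z) ⟨
      3 * ∑[ i < m ] occupies i z      ∎)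

  layer-colours-even : ∀ z → ∃ λ κ → ∑[ i < m ] colourAt i z ≡ 2 * κ
  layer-colours-even z = from-occupants (two-support (λ i → occupies i z) (λ i → m⊓n≤m 1 _) (occupants z))
    where
    from-occupants : (∃₂ λ p q → p ≢ q × (∀ r → r ≢ p → r ≢ q → occupies r z ≡ 0)) →
                     ∃ λ κ → ∑[ i < m ] colourAt i z ≡ 2 * κ
    from-occupants (p , q , p≢q , elsewhere) = colourAt p z , (begin
      ∑[ i < m ] colourAt i z      ≡⟨ ∑-two-point (λ i → colourAt i z) p≢q
                                                    (λ r r≢p r≢q → colour-empty (vacant r r≢p r≢q)) ⟩
      colourAt p z + colourAt q z  ≡⟨ cong (colourAt p z +_) (colour-complement complementary) ⟩
      colourAt p z + colourAt p z  ≡⟨ cong (colourAt p z +_) (+-identityʳ _) ⟨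
      2 * colourAt p z             ∎)
      where
      open ≡-Reasoning
      1⊓≡0 : ∀ {k} → 1 ⊓ k ≡ 0 → k ≡ 0
      1⊓≡0 {zero} _ = refl
      vacant : ∀ r → r ≢ p → r ≢ q → Empty (layer (path r) z)
      vacant r r≢p r≢q = cells≡0⇒empty (1⊓≡0 (elsewhere r r≢p r≢q))
      Bool→ℕ-complement : ∀ {x y} → Bool→ℕ x + Bool→ℕ y ≡ 1 → y ≡ not x
      Bool→ℕ-complement {false} {true}  _ = refl
      Bool→ℕ-complement {true}  {false} _ = refl
      complementary : ∀ a b → layer (path q) z a b ≡ not (layer (path p) z a b)
      complementary a b = Bool→ℕ-complement (trans
        (sym (∑-two-point (λ i → incidence i (a ∷ b ∷ z ∷ [])) p≢q
                          (λ r r≢p r≢q → cong Bool→ℕ (vacant r r≢p r≢q a b))))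
        (covered-once (a ∷ b ∷ z ∷ [])))

  n-even : ∃ λ j → n ≡ 2 * j
  n-even = ∑[ z < n ] κ z , (begin
    n                                    ≡⟨ m≡n ⟨
    m                                    ≡⟨ *-identityʳ m ⟨
    m * 1                                ≡⟨ ∑-const m 1 ⟨
    ∑[ i < m ] 1                         ≡⟨ sum-cong-≗ colour-sum ⟨
    ∑[ i < m ] ∑[ z < n ] colourAt i z   ≡⟨ ∑-comm colourAt ⟩
    ∑[ z < n ] ∑[ i < m ] colourAt i z   ≡⟨ sum-cong-≗ (proj₂ ∘ layer-colours-even) ⟩
    ∑[ z < n ] (2 * κ z)                 ≡⟨ *-distribˡ-sum 2 κ ⟨
    2 * ∑[ z < n ] κ z                   ∎)
    where
    open ≡-Reasoning
    κ : Fin n → ℕ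
    κ = proj₁ ∘ layer-colours-even

odd-cover-lower-bound : ∀ k (ps : List (PathData (V (suc (2 * k))))) → IsIsometricPathCover Adj ps →
                        suc (suc (2 * k)) ≤ length ps
odd-cover-lower-bound k ps cover with length ps ≤? suc (2 * k)
... | no  long  = ≰⇒> long
... | yes short = let j , odd≡even = ShortCover.n-even ps cover short in
                  contradiction (sym odd≡even) (even≢odd j k)

-- A cover by n + 1 paths

layerPairCover : ∀ n → List (PathData (V n))
layerPairCover zero                = []
layerPairCover (suc zero)          =
  (0F ∷ 0F ∷ 0F ∷ [] , (1F ∷ 0F ∷ 0F ∷ []) ∷ []) ∷
  (0F ∷ 1F ∷ 0F ∷ [] , (1F ∷ 1F ∷ 0F ∷ []) ∷ []) ∷ []
layerPairCover (suc (suc n))       =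
  (0F ∷ 0F ∷ 0F ∷ [] , (1F ∷ 0F ∷ 0F ∷ []) ∷ (1F ∷ 0F ∷ 1F ∷ []) ∷ (1F ∷ 1F ∷ 1F ∷ []) ∷ []) ∷
  (0F ∷ 0F ∷ 1F ∷ [] , (0F ∷ 1F ∷ 1F ∷ []) ∷ (0F ∷ 1F ∷ 0F ∷ []) ∷ (1F ∷ 1F ∷ 0F ∷ []) ∷ []) ∷
  map shift (layerPairCover n)
  where
  shift : PathData (V n) → PathData (V (suc (suc n)))
  shift (u , xs) = relabel (2 ↑ʳ_) u , map (relabel (2 ↑ʳ_)) xs

layerPairCover-isometric : ∀ n → All (λ p → IsIsometricPath Adj (proj₁ p) (proj₂ p)) (layerPairCover n)
layerPairCover-isometric zero          = []
layerPairCover-isometric (suc zero)    =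
  geodesic⇒isometric (here (λ ()) ∷ [-] , refl) ∷ geodesic⇒isometric (here (λ ()) ∷ [-] , refl) ∷ []
layerPairCover-isometric (suc (suc n)) =
  geodesic⇒isometric (here (λ ()) ∷ there (there (here (λ ()))) ∷ there (here (λ ())) ∷ [-] , refl) ∷
  geodesic⇒isometric (there (here (λ ())) ∷ there (there (here (λ ()))) ∷ here (λ ()) ∷ [-] , refl) ∷
  All.map⁺ (All.map (relabel-isometric (All.universal (λ _ → tt) _)) (layerPairCover-isometric n))
  where open Relabel {Z = λ _ → ⊤} (λ _ _ → ↑ʳ-injective 2 _ _)

layerPairCover-covers : ∀ n (v : V n) → Any (λ p → v ∈ vertices p) (layerPairCover n)
layerPairCover-covers (suc zero)    (0F ∷ 0F ∷ 0F ∷ [])        = here (here refl)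
layerPairCover-covers (suc zero)    (1F ∷ 0F ∷ 0F ∷ [])        = here (there (here refl))
layerPairCover-covers (suc zero)    (0F ∷ 1F ∷ 0F ∷ [])        = there (here (here refl))
layerPairCover-covers (suc zero)    (1F ∷ 1F ∷ 0F ∷ [])        = there (here (there (here refl)))
layerPairCover-covers (suc (suc n)) (0F ∷ 0F ∷ 0F ∷ [])        = here (here refl)
layerPairCover-covers (suc (suc n)) (1F ∷ 0F ∷ 0F ∷ [])        = here (there (here refl))
layerPairCover-covers (suc (suc n)) (1F ∷ 0F ∷ 1F ∷ [])        = here (there (there (here refl)))
layerPairCover-covers (suc (suc n)) (1F ∷ 1F ∷ 1F ∷ [])        = here (there (there (there (here refl))))
layerPairCover-covers (suc (suc n)) (0F ∷ 0F ∷ 1F ∷ [])        = there (here (here refl))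
layerPairCover-covers (suc (suc n)) (0F ∷ 1F ∷ 1F ∷ [])        = there (here (there (here refl)))
layerPairCover-covers (suc (suc n)) (0F ∷ 1F ∷ 0F ∷ [])        = there (here (there (there (here refl))))
layerPairCover-covers (suc (suc n)) (1F ∷ 1F ∷ 0F ∷ [])        = there (here (there (there (there (here refl)))))
layerPairCover-covers (suc (suc n)) (a ∷ b ∷ suc (suc z) ∷ []) =
  there (there (Any.map⁺ (Any.map (∈-map⁺ (relabel (2 ↑ʳ_))) (layerPairCover-covers n (a ∷ b ∷ z ∷ [])))))

layerPairCover-length : ∀ k → length (layerPairCover (suc (2 * k))) ≡ suc (suc (2 * k))
layerPairCover-length zero    = refl
layerPairCover-length (suc k) =
  subst (λ n → length (layerPairCover (suc n)) ≡ suc (suc n)) (sym (*-suc 2 k))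
        (cong (λ l → suc (suc l)) (trans (length-map _ (layerPairCover (suc (2 * k)))) (layerPairCover-length k)))

lemma8 : (n₃ : ℕ) → 3 ≤ n₃ → Σ ℕ (λ k → n₃ ≡ suc (2 * k)) →
    IsometricPathNumber (ProdKAdj (2 ∷ 2 ∷ n₃ ∷ [])) (suc n₃)
lemma8 n₃ _ (k , refl) =
  (layerPairCover n₃ , (layerPairCover-isometric n₃ , layerPairCover-covers n₃) , layerPairCover-length k) ,
  odd-cover-lower-bound k
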